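{- The coefficients $c_{mk}$ satisfy the following explicit formulas: \begin{align*} c_{mm}&=(m-2)!,\quad m\ge 2,\\ c_{m\,m-1}&=(m-3)!\,(3-m)\tfrac12 m,\quad m\ge 3,\\ c_{m\,m-2}&=(m-4)!\binom{m}{2}\Big[\tfrac14m^2-\tfrac{23}{12}m+\tfrac{46}{12}\Big],\quad m\ge 4,\\ c_{m\,m-3}&=(m-5)!\,(5-m)\binom{m}{3}\Big[\tfrac18m^2-\tfrac98m+\tfrac{11}{4}\Big],\quad m\ge5,\\ c_{m\,m-4}&=(m-6)!\binom{m}{4}\Big[\tfrac1{16}m^4-\tfrac{11}{8}m^3+\tfrac{553}{48}m^2-\tfrac{1747}{40}m+\tfrac{1901}{30}\Big],\quad m\ge6,\\ c_{m\,m-5}&=(m-7)!\,(7-m)\binom{m}{5}\Big[\tfrac1{32}m^4-\tfrac{37}{48}m^3+\tfrac{697}{96}m^2-\tfrac{1489}{48}m+\tfrac{611}{12}\Big],\quad m\ge7,\\ c_{m\,m-6}&=(m-8)!\binom{m}{6}\Big[\tfrac1{64}m^6-\tfrac{43}{64}m^5+\tfrac{775}{64}m^4-\tfrac{67513}{576}m^3+\tfrac{1930}{3}m^2-\tfrac{1916141}{1008}m+\tfrac{198721}{84}\Big],\quad m\ge8,\\ c_{m\,m-7}&=(m-9)!\,(9-m)\binom{m}{7}\Big[\tfrac1{128}m^6-\tfrac{47}{128}m^5+\tfrac{2777}{384}m^4-\tfrac{88093}{1152}m^3+\tfrac{14669}{32}m^2-\tfrac{425993}{288}m+\tfrac{16083}{8}\Big],\quad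 m\ge9. \end{align*}
   Context: For an integer $k\ge 2$, $\psi_k$ is the polynomial in $n$ defined by $\psi_k(n)=n+(k-1)(n-1)\binom{n+k-2}{k-1}=n+\frac{(n-1)n(n+1)\cdots(n+k-2)}{(k-2)!}$ (it has degree $k$ and zero constant and linear terms). For $m\ge2$, the rational numbers $c_{mk}$, $2\le k\le m$, are the unique coefficients such that $n^m=\sum_{k=2}^m c_{mk}\psi_k(n)$ as polynomials in $n$. -}

module Defs where

open import Data.Nat as ℕ using (ℕ; zero; suc; _∸_; _!)
open import Data.Nat.Properties using (_!≢0)
open import Data.Integer using (+_)
open import Data.Rational using (ℚ; 0ℚ; 1ℚ; _+_; _*_; _-_; _/_)

⟦_⟧ : ℕ → ℚ
⟦ n ⟧ = + n / 1

_^ℚ_ : ℚ → ℕ → ℚ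
x ^ℚ zero  = 1ℚ
x ^ℚ suc m = x * (x ^ℚ m)

risingFrom : ℚ → ℕ → ℚ
risingFrom n zero    = 1ℚ
risingFrom n (suc j) = risingFrom n j * ((n - 1ℚ) + ⟦ j ⟧)

-- ψ_k(n) = n + (n-1) n (n+1) ⋯ (n+k-2) / (k-2)!   (intended for k ≥ 2)
ψ : ℕ → ℚ → ℚ
ψ k n = n + risingFrom n k * (+ 1 / ((k ∸ 2) !)) {{(k ∸ 2) !≢0}}

-- Σ_{k=2}^{m} f k   (empty sum when m < 2)
Σ₂ : ℕ → (ℕ → ℚ) → ℚ
Σ₂ m f = go (m ∸ 1)
  where
  go : ℕ → ℚ
  go zero    = 0ℚ
  go (suc j) = go j + f (suc (suc j))

IsCoeffs : (ℕ → ℕ → ℚ) → Set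
IsCoeffs c = ∀ m → 2 ℕ.≤ m → ∀ (n : ℚ) → n ^ℚ m ≡ Σ₂ m (λ k → c m k * ψ k n)
  where open import Relation.Binary.PropositionalEquality using (_≡_)

-- Multiplying n ^ m = Σₖ c m k ψₖ(n) by n and using n ψₖ = ψ₂ + (k - 1) (ψₖ₊₁ - ψₖ),
-- together with Σₖ c m k = 1 (evaluate at n = 1), writes n ^ (m + 1) in the basis ψ₂, …, ψₘ₊₁.
-- The ψₖ are linearly independent: the rising factorial in ψₖ vanishes at 1, 0, …, 2 - k but
-- not at 1 - k, so evaluation at these points is triangular.  Comparing coefficients gives
--   c (m+1) 2 = 1 - c m 2,   c (m+1) (m+1) = (m - 1) c m m,
--   c (m+1) k = (k - 2) c m (k-1) - (k - 1) c m k   for 2 < k ≤ m.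
-- Along the diagonals c m (m - j) the middle recurrence links diagonal j to diagonal j - 1.
-- For closed forms (m - j - 2)! (m choose j) qⱼ(m) it reduces to a one-variable polynomial
-- identity between the brackets qⱼ₋₁ and qⱼ, checked by polynomial normalisation for j ≤ 7.

module Submission where

open import Defs
open import Level using (0ℓ)
open import Data.Nat as ℕ using (ℕ; zero; suc; _∸_; _≤_; _<_; z≤n; s≤s; NonZero; _!)
import Data.Nat.Properties as ℕ
open import Data.Nat.Combinatorics using (_C_; nC1≡n; nCk+nC[k+1]≡[n+1]C[k+1])
import Data.Nat.Coprimality as Coprimality
import Data.Nat.Tactic.RingSolver as ℕ-Solver
import Data.Fin as Fin
open import Data.Vec using (_∷_; [])
open import Data.Integer using (+_)
import Data.Integer as ℤ
import Data.Integer.Properties as ℤ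
open import Data.Rational using (ℚ; 0ℚ; 1ℚ; _+_; _*_; _-_; _/_; mkℚ; 1/_; ≢-nonZero)
import Data.Rational.Base as ℚ
open import Data.Rational.Properties as ℚ using (_≟_; +-*-commutativeRing; +-0-group)
open import Algebra.Properties.Group +-0-group using (∙-cancelˡ)
open import Data.Product using (_×_; _,_; proj₁; proj₂)
open import Data.Sum using (inj₁; inj₂)
open import Relation.Nullary.Decidable using (dec⇒maybe)
open import Relation.Binary.PropositionalEquality
  using (_≡_; _≢_; refl; sym; trans; cong; cong₂; subst; module ≡-Reasoning)
import Tactic.RingSolver.Core.AlmostCommutativeRing as ACR
open import Tactic.RingSolver using (solve-∀)

ℚ-ring : ACR.AlmostCommutativeRing 0ℓ 0ℓ
ℚ-ring = ACR.fromCommutativeRing +-*-commutativeRing (λ x → dec⇒maybe (0ℚ ≟ x))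

open import Tactic.RingSolver.NonReflective ℚ-ring
  using (solve; _⊜_; Expr; Κ; Ι; _⊕_; _⊗_; ⊝_; module Ops)

⟦⟧≡mkℚ : ∀ n → ⟦ n ⟧ ≡ mkℚ (+ n) 0 (Coprimality.sym (Coprimality.1-coprimeTo n))
⟦⟧≡mkℚ n = ℚ.normalize-coprime (Coprimality.sym (Coprimality.1-coprimeTo n))

⟦⟧-homo-+ : ∀ m n → ⟦ m ℕ.+ n ⟧ ≡ ⟦ m ⟧ + ⟦ n ⟧
⟦⟧-homo-+ m n rewrite ⟦⟧≡mkℚ m | ⟦⟧≡mkℚ n =
  sym (ℚ./-cong (cong₂ ℤ._+_ (ℤ.*-identityʳ (+ m)) (ℤ.*-identityʳ (+ n))) refl)

⟦⟧-homo-* : ∀ m n → ⟦ m ℕ.* n ⟧ ≡ ⟦ m ⟧ * ⟦ n ⟧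
⟦⟧-homo-* m n rewrite ⟦⟧≡mkℚ m | ⟦⟧≡mkℚ n = ℚ./-cong (ℤ.pos-* m n) refl

⟦⟧-injective : ∀ {m n} → ⟦ m ⟧ ≡ ⟦ n ⟧ → m ≡ n
⟦⟧-injective {m} {n} eq rewrite ⟦⟧≡mkℚ m | ⟦⟧≡mkℚ n = ℤ.+-injective (cong ℚ.numerator eq)

⟦1+n⟧≡⟦n⟧+1 : ∀ n → ⟦ suc n ⟧ ≡ ⟦ n ⟧ + 1ℚ
⟦1+n⟧≡⟦n⟧+1 n = trans (cong ⟦_⟧ (ℕ.+-comm 1 n)) (⟦⟧-homo-+ n 1)

⟦⟧-≢0 : ∀ n .{{_ : NonZero n}} → ⟦ n ⟧ ≢ 0ℚ
⟦⟧-≢0 n eq = ℕ.≢-nonZero⁻¹ n (⟦⟧-injective eq)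

*-cancelʳ-≢0 : ∀ {p q r} → r ≢ 0ℚ → p * r ≡ q * r → p ≡ q
*-cancelʳ-≢0 {p} {q} {r} r≢0 eq = begin
  p                  ≡⟨ sym (ℚ.*-identityʳ p) ⟩
  p * 1ℚ             ≡⟨ cong (p *_) (sym (ℚ.*-inverseʳ r)) ⟩
  p * (r * (1/ r))   ≡⟨ sym (ℚ.*-assoc p r (1/ r)) ⟩
  (p * r) * (1/ r)   ≡⟨ cong (_* (1/ r)) eq ⟩
  (q * r) * (1/ r)   ≡⟨ ℚ.*-assoc q r (1/ r) ⟩
  q * (r * (1/ r))   ≡⟨ cong (q *_) (ℚ.*-inverseʳ r) ⟩
  q * 1ℚ             ≡⟨ ℚ.*-identityʳ q ⟩
  q                  ∎
  where
  open ≡-Reasoning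
  instance _ = ≢-nonZero r≢0

*-cancelˡ-≢0 : ∀ {p q r} → r ≢ 0ℚ → r * p ≡ r * q → p ≡ q
*-cancelˡ-≢0 {p} {q} {r} r≢0 eq =
  *-cancelʳ-≢0 r≢0 (trans (ℚ.*-comm p r) (trans eq (ℚ.*-comm r q)))

*-≢0 : ∀ {p q} → p ≢ 0ℚ → q ≢ 0ℚ → p * q ≢ 0ℚ
*-≢0 {p} {q} p≢0 q≢0 pq≡0 = p≢0 (*-cancelʳ-≢0 q≢0 (trans pq≡0 (sym (ℚ.*-zeroˡ q))))

1/n*n≡1 : ∀ n .{{_ : NonZero n}} → (+ 1 / n) * ⟦ n ⟧ ≡ 1ℚ
1/n*n≡1 (suc d)
  rewrite ⟦⟧≡mkℚ (suc d) | ℚ.normalize-coprime {1} {d} (Coprimality.1-coprimeTo (suc d)) =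
  ℚ.*-inverseˡ (mkℚ (+ suc d) 0 (Coprimality.sym (Coprimality.1-coprimeTo (suc d))))

1/[_!] : ℕ → ℚ
1/[ i !] = (+ 1 / (i !)) {{i ℕ.!≢0}}

1/[n!]-≢0 : ∀ i → 1/[ i !] ≢ 0ℚ
1/[n!]-≢0 i eq = 0≢1 (begin
  0ℚ                ≡⟨ sym (ℚ.*-zeroˡ ⟦ i ! ⟧) ⟩
  0ℚ * ⟦ i ! ⟧      ≡⟨ cong (_* ⟦ i ! ⟧) (sym eq) ⟩
  1/[ i !] * ⟦ i ! ⟧ ≡⟨ 1/n*n≡1 (i !) {{i ℕ.!≢0}} ⟩
  1ℚ                ∎)
  where
  open ≡-Reasoning
  0≢1 : 0ℚ ≢ 1ℚ
  0≢1 ()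

1/[n!]≡[1+n]*1/[[1+n]!] : ∀ i → 1/[ i !] ≡ ⟦ suc i ⟧ * 1/[ suc i !]
1/[n!]≡[1+n]*1/[[1+n]!] i = *-cancelʳ-≢0 (⟦⟧-≢0 (i !) {{i ℕ.!≢0}}) (begin
  1/[ i !] * ⟦ i ! ⟧                      ≡⟨ 1/n*n≡1 (i !) {{i ℕ.!≢0}} ⟩
  1ℚ                                      ≡⟨ sym (1/n*n≡1 (suc i !) {{suc i ℕ.!≢0}}) ⟩
  1/[ suc i !] * ⟦ suc i ! ⟧              ≡⟨ cong (1/[ suc i !] *_) (⟦⟧-homo-* (suc i) (i !)) ⟩
  1/[ suc i !] * (⟦ suc i ⟧ * ⟦ i ! ⟧)    ≡⟨ regroup 1/[ suc i !] ⟦ suc i ⟧ ⟦ i ! ⟧ ⟩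
  ⟦ suc i ⟧ * 1/[ suc i !] * ⟦ i ! ⟧      ∎)
  where
  open ≡-Reasoning
  regroup : ∀ w a f → w * (a * f) ≡ a * w * f
  regroup = solve-∀ ℚ-ring

1^ℚn≡1 : ∀ n → 1ℚ ^ℚ n ≡ 1ℚ
1^ℚn≡1 zero    = refl
1^ℚn≡1 (suc n) = trans (ℚ.*-identityˡ (1ℚ ^ℚ n)) (1^ℚn≡1 n)

sumBelow : ℕ → (ℕ → ℚ) → ℚ
sumBelow zero    f = 0ℚ
sumBelow (suc J) f = sumBelow J f + f J

Σ₂≡sumBelow : ∀ J f → Σ₂ (suc J) f ≡ sumBelow J (λ i → f (2 ℕ.+ i))
Σ₂≡sumBelow zero    f = refl
Σ₂≡sumBelow (suc J) f = cong (_+ f (suc (suc J))) (Σ₂≡sumBelow J f)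

sumBelow-cong : ∀ J {f g} → (∀ i → i < J → f i ≡ g i) → sumBelow J f ≡ sumBelow J g
sumBelow-cong zero    f≡g = refl
sumBelow-cong (suc J) f≡g =
  cong₂ _+_ (sumBelow-cong J (λ i i<J → f≡g i (ℕ.m<n⇒m<1+n i<J))) (f≡g J ℕ.≤-refl)

root : ℕ → ℚ
root j = 1ℚ - ⟦ j ⟧

risingFrom-root : ∀ {j k} → j < k → risingFrom (root j) k ≡ 0ℚ
risingFrom-root {j} {suc k} j<1+k with ℕ.m<1+n⇒m<n∨m≡n j<1+k
... | inj₁ j<k  = trans (cong (_* factor) (risingFrom-root j<k)) (ℚ.*-zeroˡ factor)
  where
  factor : ℚ
  factor = (root j - 1ℚ) + ⟦ k ⟧
... | inj₂ refl =
  trans (cong (risingFrom (root j) j *_) (last-factor ⟦ j ⟧)) (ℚ.*-zeroʳ (risingFrom (root j) j))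
  where
  last-factor : ∀ x → ((1ℚ - x) - 1ℚ) + x ≡ 0ℚ
  last-factor = solve-∀ ℚ-ring

risingFrom-root-≢0 : ∀ {j k} → k ≤ j → risingFrom (root j) k ≢ 0ℚ
risingFrom-root-≢0 {j} {zero}  _     ()
risingFrom-root-≢0 {j} {suc k} 1+k≤j = *-≢0 (risingFrom-root-≢0 (ℕ.<⇒≤ 1+k≤j)) factor-≢0
  where
  factor-≢0 : (root j - 1ℚ) + ⟦ k ⟧ ≢ 0ℚ
  factor-≢0 eq = ℕ.<⇒≢ 1+k≤j (⟦⟧-injective (begin
    ⟦ k ⟧                                ≡⟨ shift ⟦ k ⟧ ⟦ j ⟧ ⟩
    ((1ℚ - ⟦ j ⟧ - 1ℚ) + ⟦ k ⟧) + ⟦ j ⟧  ≡⟨ cong (_+ ⟦ j ⟧) eq ⟩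
    0ℚ + ⟦ j ⟧                           ≡⟨ ℚ.+-identityˡ ⟦ j ⟧ ⟩
    ⟦ j ⟧                                ∎))
    where
    open ≡-Reasoning
    shift : ∀ k j → k ≡ ((1ℚ - j - 1ℚ) + k) + j
    shift = solve-∀ ℚ-ring

ρ : ℕ → ℚ → ℚ
ρ i n = risingFrom n (2 ℕ.+ i) * 1/[ i !]

ρ-root : ∀ {i j} → j < 2 ℕ.+ i → ρ i (root j) ≡ 0ℚ
ρ-root {i} j<2+i = trans (cong (_* 1/[ i !]) (risingFrom-root j<2+i)) (ℚ.*-zeroˡ 1/[ i !])

ρ-root-≢0 : ∀ i → ρ i (root (2 ℕ.+ i)) ≢ 0ℚ
ρ-root-≢0 i = *-≢0 (risingFrom-root-≢0 {2 ℕ.+ i} ℕ.≤-refl) (1/[n!]-≢0 i)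

ψ-at-1 : ∀ i → ψ (2 ℕ.+ i) 1ℚ ≡ 1ℚ
ψ-at-1 i = trans (cong (_+_ 1ℚ) (ρ-root {i} {0} (s≤s z≤n))) (ℚ.+-identityʳ 1ℚ)

combination : (ℕ → ℚ) → ℕ → ℚ → ℚ
combination a J n = sumBelow J (λ i → a i * ψ (2 ℕ.+ i) n)

risingPart : (ℕ → ℚ) → ℕ → ℚ → ℚ
risingPart a J n = sumBelow J (λ i → a i * ρ i n)

combination-at-1 : ∀ a J → combination a J 1ℚ ≡ sumBelow J a
combination-at-1 a zero    = refl
combination-at-1 a (suc J) =
  cong₂ _+_ (combination-at-1 a J) (trans (cong (a J *_) (ψ-at-1 J)) (ℚ.*-identityʳ (a J)))

combination-split : ∀ a J γ n →
  combination a J n + γ * ψ (2 ℕ.+ J) n ≡ n * (sumBelow J a + γ) + (risingPart a J n + γ * ρ J n)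
combination-split a zero    γ n = first n γ (ρ 0 n)
  where
  first : ∀ n γ p → 0ℚ + γ * (n + p) ≡ n * (0ℚ + γ) + (0ℚ + γ * p)
  first = solve-∀ ℚ-ring
combination-split a (suc J) γ n = begin
  (combination a J n + a J * ψ (2 ℕ.+ J) n) + γ * (n + ρ (suc J) n)
    ≡⟨ cong (_+ γ * (n + ρ (suc J) n)) (combination-split a J (a J) n) ⟩
  (n * (sumBelow J a + a J) + (risingPart a J n + a J * ρ J n)) + γ * (n + ρ (suc J) n)
    ≡⟨ regroup n (sumBelow J a + a J) (risingPart a J n + a J * ρ J n) γ (ρ (suc J) n) ⟩
  n * (sumBelow J a + a J + γ) + (risingPart a J n + a J * ρ J n + γ * ρ (suc J) n) ∎
  where
  open ≡-Reasoning
  regroup : ∀ n s r x p → (n * s + r) + x * (n + p) ≡ n * (s + x) + (r + x * p)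
  regroup = solve-∀ ℚ-ring

top-coefficient : ∀ J {a b α β} → (∀ i → i < J → a i ≡ b i) →
  risingPart a J (root (2 ℕ.+ J)) + α * ρ J (root (2 ℕ.+ J))
    ≡ risingPart b J (root (2 ℕ.+ J)) + β * ρ J (root (2 ℕ.+ J)) →
  α ≡ β
top-coefficient J {a} {b} {α} a≡b eq =
  *-cancelʳ-≢0 (ρ-root-≢0 J) (∙-cancelˡ (risingPart b J r) _ _ (trans (cong (_+ α * ρ J r) b≡a) eq))
  where
  r : ℚ
  r = root (2 ℕ.+ J)
  b≡a : risingPart b J r ≡ risingPart a J r
  b≡a = sumBelow-cong J (λ i i<J → cong (_* ρ i r) (sym (a≡b i i<J)))

risingPart-independent : ∀ J a b α β →
  (∀ j → j ≤ 2 ℕ.+ J →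
     risingPart a J (root j) + α * ρ J (root j) ≡ risingPart b J (root j) + β * ρ J (root j)) →
  (∀ i → i < J → a i ≡ b i) × α ≡ β
risingPart-independent zero a b α β eq = (λ _ ()) , top-coefficient zero {a} {b} (λ _ ()) (eq 2 ℕ.≤-refl)
risingPart-independent (suc J) a b α β eq = lower , top-coefficient (suc J) lower (eq (3 ℕ.+ J) ℕ.≤-refl)
  where
  drop-top : ∀ c γ j → j ≤ 2 ℕ.+ J →
    risingPart c (suc J) (root j) + γ * ρ (suc J) (root j) ≡ risingPart c (suc J) (root j)
  drop-top c γ j j≤2+J =
    trans (cong (λ z → risingPart c (suc J) (root j) + γ * z) (ρ-root (s≤s j≤2+J))) (x+y*0≡x _ γ)
    where
    x+y*0≡x : ∀ x y → x + y * 0ℚ ≡ x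
    x+y*0≡x = solve-∀ ℚ-ring
  lower-eq : ∀ j → j ≤ 2 ℕ.+ J → risingPart a (suc J) (root j) ≡ risingPart b (suc J) (root j)
  lower-eq j j≤2+J =
    trans (sym (drop-top a α j j≤2+J)) (trans (eq j (ℕ.m≤n⇒m≤1+n j≤2+J)) (drop-top b β j j≤2+J))
  ih : (∀ i → i < J → a i ≡ b i) × a J ≡ b J
  ih = risingPart-independent J a b (a J) (b J) lower-eq
  lower : ∀ i → i < suc J → a i ≡ b i
  lower i i<1+J with ℕ.m<1+n⇒m<n∨m≡n i<1+J
  ... | inj₁ i<J  = proj₁ ih i i<J
  ... | inj₂ refl = proj₂ ih

combination-independent : ∀ J a b α β →
  (∀ n → combination a J n + α * ψ (2 ℕ.+ J) n ≡ combination b J n + β * ψ (2 ℕ.+ J) n) →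
  (∀ i → i < J → a i ≡ b i) × α ≡ β
combination-independent J a b α β eq =
  risingPart-independent J a b α β (λ j _ → rising-eq (root j))
  where
  open ≡-Reasoning
  sums : sumBelow J a + α ≡ sumBelow J b + β
  sums = begin
    sumBelow J a + α                            ≡⟨ sym (value-at-1 a α) ⟩
    combination a J 1ℚ + α * ψ (2 ℕ.+ J) 1ℚ     ≡⟨ eq 1ℚ ⟩
    combination b J 1ℚ + β * ψ (2 ℕ.+ J) 1ℚ     ≡⟨ value-at-1 b β ⟩
    sumBelow J b + β                            ∎
    where
    value-at-1 : ∀ c γ → combination c J 1ℚ + γ * ψ (2 ℕ.+ J) 1ℚ ≡ sumBelow J c + γ
    value-at-1 c γ = cong₂ _+_ (combination-at-1 c J) (trans (cong (γ *_) (ψ-at-1 J)) (ℚ.*-identityʳ γ))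
  rising-eq : ∀ n → risingPart a J n + α * ρ J n ≡ risingPart b J n + β * ρ J n
  rising-eq n = ∙-cancelˡ (n * (sumBelow J a + α)) _ _ (begin
    n * (sumBelow J a + α) + (risingPart a J n + α * ρ J n) ≡⟨ sym (combination-split a J α n) ⟩
    combination a J n + α * ψ (2 ℕ.+ J) n                    ≡⟨ eq n ⟩
    combination b J n + β * ψ (2 ℕ.+ J) n                    ≡⟨ combination-split b J β n ⟩
    n * (sumBelow J b + β) + (risingPart b J n + β * ρ J n) ≡⟨ cong (λ s → n * s + _) (sym sums) ⟩
    n * (sumBelow J a + α) + (risingPart b J n + β * ρ J n) ∎)

ψ₂≡n*n : ∀ n → ψ 2 n ≡ n * n
ψ₂≡n*n = expand
  where
  -- solve-∀ does not unfold ψ, so ψ 2 n is spelled out.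
  expand : ∀ n → n + 1ℚ * ((n - 1ℚ) + ⟦ 0 ⟧) * ((n - 1ℚ) + ⟦ 1 ⟧) * (+ 1 / 1) ≡ n * n
  expand = solve-∀ ℚ-ring

*-ψ : ∀ i n → n * ψ (2 ℕ.+ i) n ≡ ψ 2 n + ⟦ suc i ⟧ * (ψ (3 ℕ.+ i) n - ψ (2 ℕ.+ i) n)
*-ψ i n = begin
  n * (n + R * 1/[ i !])
    ≡⟨ cong (λ u → n * (n + R * u)) (1/[n!]≡[1+n]*1/[[1+n]!] i) ⟩
  n * (n + R * (A * w))
    ≡⟨ identity n R A w ⟩
  n * n + A * ((n + R * ((n - 1ℚ) + (1ℚ + A)) * w) - (n + R * (A * w)))
    ≡⟨ cong₂ (λ s z → s + A * ((n + R * ((n - 1ℚ) + z) * w) - (n + R * (A * w))))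
             (sym (ψ₂≡n*n n)) (sym (⟦⟧-homo-+ 1 (suc i))) ⟩
  ψ 2 n + A * (ψ (3 ℕ.+ i) n - (n + R * (A * w)))
    ≡⟨ cong (λ u → ψ 2 n + A * (ψ (3 ℕ.+ i) n - (n + R * u))) (sym (1/[n!]≡[1+n]*1/[[1+n]!] i)) ⟩
  ψ 2 n + A * (ψ (3 ℕ.+ i) n - ψ (2 ℕ.+ i) n) ∎
  where
  open ≡-Reasoning
  R A w : ℚ
  R = risingFrom n (2 ℕ.+ i)
  A = ⟦ suc i ⟧
  w = 1/[ suc i !]
  identity : ∀ n R A w →
    n * (n + R * (A * w)) ≡ n * n + A * ((n + R * ((n - 1ℚ) + (1ℚ + A)) * w) - (n + R * (A * w)))
  identity = solve-∀ ℚ-ring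

*-combination : ∀ a J n →
  n * combination a J n
    ≡ sumBelow J a * ψ 2 n + sumBelow J (λ i → ⟦ suc i ⟧ * a i * (ψ (3 ℕ.+ i) n - ψ (2 ℕ.+ i) n))
*-combination a zero n = zero-sums n (ψ 2 n)
  where
  zero-sums : ∀ n p → n * 0ℚ ≡ 0ℚ * p + 0ℚ
  zero-sums = solve-∀ ℚ-ring
*-combination a (suc J) n = begin
  n * (combination a J n + a J * ψ (2 ℕ.+ J) n)
    ≡⟨ distrib n (combination a J n) (a J) (ψ (2 ℕ.+ J) n) ⟩
  n * combination a J n + a J * (n * ψ (2 ℕ.+ J) n)
    ≡⟨ cong₂ (λ x y → x + a J * y) (*-combination a J n) (*-ψ J n) ⟩
  (sumBelow J a * ψ 2 n + T) + a J * (ψ 2 n + ⟦ suc J ⟧ * (ψ (3 ℕ.+ J) n - ψ (2 ℕ.+ J) n))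
    ≡⟨ regroup (sumBelow J a) (ψ 2 n) T (a J) ⟦ suc J ⟧ (ψ (3 ℕ.+ J) n) (ψ (2 ℕ.+ J) n) ⟩
  (sumBelow J a + a J) * ψ 2 n + (T + ⟦ suc J ⟧ * a J * (ψ (3 ℕ.+ J) n - ψ (2 ℕ.+ J) n)) ∎
  where
  open ≡-Reasoning
  T : ℚ
  T = sumBelow J (λ i → ⟦ suc i ⟧ * a i * (ψ (3 ℕ.+ i) n - ψ (2 ℕ.+ i) n))
  distrib : ∀ n c x p → n * (c + x * p) ≡ n * c + x * (n * p)
  distrib = solve-∀ ℚ-ring
  regroup : ∀ s q t x A p₃ p₂ →
    (s * q + t) + x * (q + A * (p₃ - p₂)) ≡ (s + x) * q + (t + A * x * (p₃ - p₂))
  regroup = solve-∀ ℚ-ring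

-- The ψ-coefficients of n · Σᵢ aᵢ ψ₂₊ᵢ when Σᵢ aᵢ = 1, except the top one: for a row a 0, …, a J,
-- nextRow a (suc J) would read a (suc J), so the top coefficient ⟦ suc J ⟧ * a J is kept apart.
nextRow : (ℕ → ℚ) → ℕ → ℚ
nextRow a zero    = 1ℚ - a 0
nextRow a (suc i) = ⟦ suc i ⟧ * a i - ⟦ 2 ℕ.+ i ⟧ * a (suc i)

summation-by-parts : ∀ a (g : ℕ → ℚ) J →
  g 0 + sumBelow (suc J) (λ i → ⟦ suc i ⟧ * a i * (g (suc i) - g i))
    ≡ sumBelow (suc J) (λ i → nextRow a i * g i) + ⟦ suc J ⟧ * a J * g (suc J)
summation-by-parts a g zero = first (g 0) (g 1) (a 0)
  where
  first : ∀ g₀ g₁ x → g₀ + (0ℚ + ⟦ 1 ⟧ * x * (g₁ - g₀)) ≡ (0ℚ + (1ℚ - x) * g₀) + ⟦ 1 ⟧ * x * g₁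
  first = solve-∀ ℚ-ring
summation-by-parts a g (suc J) = begin
  g 0 + (T + t)                          ≡⟨ sym (ℚ.+-assoc (g 0) T t) ⟩
  (g 0 + T) + t                          ≡⟨ cong (_+ t) (summation-by-parts a g J) ⟩
  (N + ⟦ suc J ⟧ * a J * g (suc J)) + t
    ≡⟨ regroup N ⟦ suc J ⟧ (a J) ⟦ 2 ℕ.+ J ⟧ (a (suc J)) (g (suc J)) (g (2 ℕ.+ J)) ⟩
  (N + nextRow a (suc J) * g (suc J)) + ⟦ 2 ℕ.+ J ⟧ * a (suc J) * g (2 ℕ.+ J) ∎
  where
  open ≡-Reasoning
  T t N : ℚ
  T = sumBelow (suc J) (λ i → ⟦ suc i ⟧ * a i * (g (suc i) - g i))
  t = ⟦ 2 ℕ.+ J ⟧ * a (suc J) * (g (2 ℕ.+ J) - g (suc J))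
  N = sumBelow (suc J) (λ i → nextRow a i * g i)
  regroup : ∀ N A x B y p q →
    (N + A * x * p) + B * y * (q - p) ≡ (N + (A * x - B * y) * p) + B * y * q
  regroup = solve-∀ ℚ-ring

*-combination-nextRow : ∀ a J n → sumBelow (suc J) a ≡ 1ℚ →
  n * combination a (suc J) n ≡ combination (nextRow a) (suc J) n + ⟦ suc J ⟧ * a J * ψ (3 ℕ.+ J) n
*-combination-nextRow a J n a-sums-to-1 = begin
  n * combination a (suc J) n                          ≡⟨ *-combination a (suc J) n ⟩
  sumBelow (suc J) a * ψ 2 n + T                       ≡⟨ cong (λ s → s * ψ 2 n + T) a-sums-to-1 ⟩
  1ℚ * ψ 2 n + T                                       ≡⟨ cong (_+ T) (ℚ.*-identityˡ (ψ 2 n)) ⟩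
  ψ 2 n + T                                            ≡⟨ summation-by-parts a (λ i → ψ (2 ℕ.+ i) n) J ⟩
  combination (nextRow a) (suc J) n + ⟦ suc J ⟧ * a J * ψ (3 ℕ.+ J) n ∎
  where
  open ≡-Reasoning
  T : ℚ
  T = sumBelow (suc J) (λ i → ⟦ suc i ⟧ * a i * (ψ (3 ℕ.+ i) n - ψ (2 ℕ.+ i) n))

[1+k]*[1+n]C[1+k]≡[1+n]*nCk : ∀ n k → suc k ℕ.* (suc n C suc k) ≡ suc n ℕ.* (n C k)
[1+k]*[1+n]C[1+k]≡[1+n]*nCk zero    zero    = refl
[1+k]*[1+n]C[1+k]≡[1+n]*nCk zero    (suc k) = ℕ.*-zeroʳ (2 ℕ.+ k)
[1+k]*[1+n]C[1+k]≡[1+n]*nCk (suc n) zero    =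
  trans (ℕ.+-identityʳ _) (trans (nC1≡n (2 ℕ.+ n)) (sym (ℕ.*-identityʳ (2 ℕ.+ n))))
[1+k]*[1+n]C[1+k]≡[1+n]*nCk (suc n) (suc k) = begin
  (2 ℕ.+ k) ℕ.* ((2 ℕ.+ n) C (2 ℕ.+ k))
    ≡⟨ cong ((2 ℕ.+ k) ℕ.*_) (sym (nCk+nC[k+1]≡[n+1]C[k+1] (suc n) (suc k))) ⟩
  (2 ℕ.+ k) ℕ.* (A ℕ.+ B)
    ≡⟨ regroup k A B ⟩
  A ℕ.+ ((1 ℕ.+ k) ℕ.* A ℕ.+ (2 ℕ.+ k) ℕ.* B)
    ≡⟨ cong₂ (λ x y → A ℕ.+ (x ℕ.+ y))
             ([1+k]*[1+n]C[1+k]≡[1+n]*nCk n k) ([1+k]*[1+n]C[1+k]≡[1+n]*nCk n (suc k)) ⟩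
  A ℕ.+ ((1 ℕ.+ n) ℕ.* (n C k) ℕ.+ (1 ℕ.+ n) ℕ.* (n C suc k))
    ≡⟨ cong (A ℕ.+_) (sym (ℕ.*-distribˡ-+ (suc n) (n C k) (n C suc k))) ⟩
  A ℕ.+ (1 ℕ.+ n) ℕ.* (n C k ℕ.+ n C suc k)
    ≡⟨ cong (λ x → A ℕ.+ (1 ℕ.+ n) ℕ.* x) (nCk+nC[k+1]≡[n+1]C[k+1] n k) ⟩
  A ℕ.+ (1 ℕ.+ n) ℕ.* A ∎
  where
  open ≡-Reasoning
  A B : ℕ
  A = suc n C suc k
  B = suc n C (2 ℕ.+ k)
  regroup : ∀ k a b → (2 ℕ.+ k) ℕ.* (a ℕ.+ b) ≡ a ℕ.+ ((1 ℕ.+ k) ℕ.* a ℕ.+ (2 ℕ.+ k) ℕ.* b)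
  regroup = ℕ-Solver.solve-∀

closedForm : ℕ → (ℚ → ℚ) → ℕ → ℚ
closedForm j q t = ⟦ t ! ⟧ * ⟦ (2 ℕ.+ j ℕ.+ t) C j ⟧ * q ⟦ 2 ℕ.+ j ℕ.+ t ⟧

-- The diagonal recurrence for closed forms t! C(n, k) q′(n) on diagonal k and t! C(n, k-1) q(n)
-- on diagonal k - 1 (n the row), divided by (t+1)! C(n, k-1) / k.
ShiftIdentity : ℕ → (ℚ → ℚ) → (ℚ → ℚ) → Set
ShiftIdentity k q q′ =
  ∀ M → (M + 1ℚ) * q′ (M + 1ℚ) ≡ (M + 1ℚ - ⟦ k ⟧) * q′ M - ⟦ k ⟧ * (M - ⟦ k ⟧) * q M

-- Multiplying through by a turns the absorption identity a Z = (M + 1) X into a substitution.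
closedForm-step : ∀ {a s u M F F′ X Y Z p p′ p″} →
  u ≡ s + 1ℚ → M ≡ a + u → F′ ≡ s * F → X + Y ≡ Z → a ≢ 0ℚ →
  a * Z ≡ (M + 1ℚ) * X → (M + 1ℚ) * p″ ≡ (M + 1ℚ - a) * p′ - a * (M - a) * p →
  s * (F * Y * p′) - u * (F′ * X * p) ≡ F′ * Z * p″
closedForm-step {a} {s} {F = F} {X = X} {Y} {p = p} {p′} {p″} refl refl refl refl a≢0 absorb shift =
  *-cancelˡ-≢0 a≢0 (begin
    a * (s * (F * Y * p′) - (s + 1ℚ) * (s * F * X * p))
      ≡⟨ expand a s F X Y p p′ ⟩
    s * F * (p′ * (a * (X + Y)) - X * (a * p′ + a * (s + 1ℚ) * p))
      ≡⟨ cong (λ z → s * F * (p′ * z - X * (a * p′ + a * (s + 1ℚ) * p))) absorb ⟩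
    s * F * (p′ * ((M + 1ℚ) * X) - X * (a * p′ + a * (s + 1ℚ) * p))
      ≡⟨ factor a s F X p p′ ⟩
    s * F * X * ((M + 1ℚ - a) * p′ - a * (M - a) * p)
      ≡⟨ cong (s * F * X *_) (sym shift) ⟩
    s * F * X * ((M + 1ℚ) * p″)
      ≡⟨ swap (s * F) X (M + 1ℚ) p″ ⟩
    s * F * p″ * ((M + 1ℚ) * X)
      ≡⟨ cong (s * F * p″ *_) (sym absorb) ⟩
    s * F * p″ * (a * (X + Y))
      ≡⟨ collect (s * F) p″ a (X + Y) ⟩
    a * (s * F * (X + Y) * p″) ∎)
  where
  open ≡-Reasoning
  M : ℚ
  M = a + (s + 1ℚ)
  expand : ∀ a s F X Y p p′ → a * (s * (F * Y * p′) - (s + 1ℚ) * (s * F * X * p))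
                             ≡ s * F * (p′ * (a * (X + Y)) - X * (a * p′ + a * (s + 1ℚ) * p))
  expand = solve-∀ ℚ-ring
  factor : ∀ a s F X p p′ →
    s * F * (p′ * ((a + (s + 1ℚ) + 1ℚ) * X) - X * (a * p′ + a * (s + 1ℚ) * p))
      ≡ s * F * X * ((a + (s + 1ℚ) + 1ℚ - a) * p′ - a * (a + (s + 1ℚ) - a) * p)
  factor = solve-∀ ℚ-ring
  swap : ∀ f x m p → f * x * (m * p) ≡ f * p * (m * x)
  swap = solve-∀ ℚ-ring
  collect : ∀ f p a z → f * p * (a * z) ≡ a * (f * z * p)
  collect = solve-∀ ℚ-ring

closedForm-recurrence : ∀ j t {q q′} → ShiftIdentity (suc j) q q′ →
  ⟦ suc t ⟧ * closedForm (suc j) q′ t - ⟦ 2 ℕ.+ t ⟧ * closedForm j q (suc t)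
    ≡ closedForm (suc j) q′ (suc t)
closedForm-recurrence j t {q} {q′} shift = begin
  ⟦ suc t ⟧ * closedForm (suc j) q′ t - ⟦ 2 ℕ.+ t ⟧ * closedForm j q (suc t)
    ≡⟨ cong (λ r → ⟦ suc t ⟧ * (⟦ t ! ⟧ * ⟦ r C suc j ⟧ * q′ ⟦ r ⟧) - ⟦ 2 ℕ.+ t ⟧ * closedForm j q (suc t))
             row≡n ⟩
  ⟦ suc t ⟧ * (⟦ t ! ⟧ * ⟦ n C suc j ⟧ * q′ ⟦ n ⟧) - ⟦ 2 ℕ.+ t ⟧ * (⟦ suc t ! ⟧ * ⟦ n C j ⟧ * q ⟦ n ⟧)
    ≡⟨ closedForm-step {s = ⟦ suc t ⟧} {F = ⟦ t ! ⟧} (⟦1+n⟧≡⟦n⟧+1 (suc t)) ⟦n⟧≡⟦1+j⟧+⟦2+t⟧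
                       (⟦⟧-homo-* (suc t) (t !)) pascal (⟦⟧-≢0 (suc j)) absorption shift-at-n ⟩
  closedForm (suc j) q′ (suc t) ∎
  where
  open ≡-Reasoning
  n : ℕ
  n = 2 ℕ.+ (j ℕ.+ suc t)
  row≡n : 3 ℕ.+ (j ℕ.+ t) ≡ n
  row≡n = cong (2 ℕ.+_) (sym (ℕ.+-suc j t))
  ⟦n⟧≡⟦1+j⟧+⟦2+t⟧ : ⟦ n ⟧ ≡ ⟦ suc j ⟧ + ⟦ 2 ℕ.+ t ⟧
  ⟦n⟧≡⟦1+j⟧+⟦2+t⟧ =
    trans (cong (λ r → ⟦ suc r ⟧) (sym (ℕ.+-suc j (suc t)))) (⟦⟧-homo-+ (suc j) (2 ℕ.+ t))
  pascal : ⟦ n C j ⟧ + ⟦ n C suc j ⟧ ≡ ⟦ suc n C suc j ⟧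
  pascal = trans (sym (⟦⟧-homo-+ (n C j) (n C suc j))) (cong ⟦_⟧ (nCk+nC[k+1]≡[n+1]C[k+1] n j))
  absorption : ⟦ suc j ⟧ * ⟦ suc n C suc j ⟧ ≡ (⟦ n ⟧ + 1ℚ) * ⟦ n C j ⟧
  absorption = begin
    ⟦ suc j ⟧ * ⟦ suc n C suc j ⟧      ≡⟨ sym (⟦⟧-homo-* (suc j) (suc n C suc j)) ⟩
    ⟦ suc j ℕ.* (suc n C suc j) ⟧      ≡⟨ cong ⟦_⟧ ([1+k]*[1+n]C[1+k]≡[1+n]*nCk n j) ⟩
    ⟦ suc n ℕ.* (n C j) ⟧              ≡⟨ ⟦⟧-homo-* (suc n) (n C j) ⟩
    ⟦ suc n ⟧ * ⟦ n C j ⟧              ≡⟨ cong (_* ⟦ n C j ⟧) (⟦1+n⟧≡⟦n⟧+1 n) ⟩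
    (⟦ n ⟧ + 1ℚ) * ⟦ n C j ⟧           ∎
  shift-at-n : (⟦ n ⟧ + 1ℚ) * q′ ⟦ suc n ⟧
                 ≡ (⟦ n ⟧ + 1ℚ - ⟦ suc j ⟧) * q′ ⟦ n ⟧ - ⟦ suc j ⟧ * (⟦ n ⟧ - ⟦ suc j ⟧) * q ⟦ n ⟧
  shift-at-n = trans (cong (λ x → (⟦ n ⟧ + 1ℚ) * q′ x) (⟦1+n⟧≡⟦n⟧+1 n)) (shift ⟦ n ⟧)

fromOffset : ∀ k {P : ℕ → Set} → (∀ t → P (k ℕ.+ t)) → ∀ m → k ≤ m → P m
fromOffset k {P} h m k≤m = subst P (ℕ.m+[n∸m]≡n k≤m) (h (m ∸ k))

-- Brackets are written as one-variable solver expressions: NonReflective.solve checks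
-- each shift identity by normalisation, and bracket evaluates them to exactly the
-- rational terms appearing in the statement.
Bracket : Set
Bracket = ∀ {n} → Expr ℚ n → Expr ℚ n

infixl 6 _⊖_
infixr 8 _^_

_⊖_ : ∀ {n} → Expr ℚ n → Expr ℚ n → Expr ℚ n
x ⊖ y = x ⊕ ⊝ y

_^_ : ∀ {n} → Expr ℚ n → ℕ → Expr ℚ n
x ^ zero  = Κ 1ℚ
x ^ suc k = x ⊗ x ^ k

bracket : Bracket → ℚ → ℚ
bracket q M = Ops.⟦ q (Ι Fin.zero) ⟧ (M ∷ [])

signed : ℕ → Bracket → Bracket
signed e B M = (Κ ⟦ e ⟧ ⊖ M) ⊗ B M

B₁ B₂ B₃ B₄ B₅ B₆ B₇ : Bracket
B₁ M = Κ (+ 1 / 2)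
B₂ M = Κ (+ 1 / 4) ⊗ M ^ 2 ⊖ Κ (+ 23 / 12) ⊗ M ⊕ Κ (+ 46 / 12)
B₃ M = Κ (+ 1 / 8) ⊗ M ^ 2 ⊖ Κ (+ 9 / 8) ⊗ M ⊕ Κ (+ 11 / 4)
B₄ M = Κ (+ 1 / 16) ⊗ M ^ 4 ⊖ Κ (+ 11 / 8) ⊗ M ^ 3 ⊕ Κ (+ 553 / 48) ⊗ M ^ 2
  ⊖ Κ (+ 1747 / 40) ⊗ M ⊕ Κ (+ 1901 / 30)
B₅ M = Κ (+ 1 / 32) ⊗ M ^ 4 ⊖ Κ (+ 37 / 48) ⊗ M ^ 3 ⊕ Κ (+ 697 / 96) ⊗ M ^ 2
  ⊖ Κ (+ 1489 / 48) ⊗ M ⊕ Κ (+ 611 / 12)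
B₆ M = Κ (+ 1 / 64) ⊗ M ^ 6 ⊖ Κ (+ 43 / 64) ⊗ M ^ 5 ⊕ Κ (+ 775 / 64) ⊗ M ^ 4
  ⊖ Κ (+ 67513 / 576) ⊗ M ^ 3 ⊕ Κ (+ 1930 / 3) ⊗ M ^ 2
  ⊖ Κ (+ 1916141 / 1008) ⊗ M ⊕ Κ (+ 198721 / 84)
B₇ M = Κ (+ 1 / 128) ⊗ M ^ 6 ⊖ Κ (+ 47 / 128) ⊗ M ^ 5 ⊕ Κ (+ 2777 / 384) ⊗ M ^ 4
  ⊖ Κ (+ 88093 / 1152) ⊗ M ^ 3 ⊕ Κ (+ 14669 / 32) ⊗ M ^ 2
  ⊖ Κ (+ 425993 / 288) ⊗ M ⊕ Κ (+ 16083 / 8)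

q₀ q₁ q₂ q₃ q₄ q₅ q₆ q₇ : Bracket
q₀ M = Κ 1ℚ
q₁ = signed 3 B₁
q₂ = B₂
q₃ = signed 5 B₃
q₄ = B₄
q₅ = signed 7 B₅
q₆ = B₆
q₇ = signed 9 B₇

shiftˡ : Bracket → Bracket
shiftˡ q′ M = (M ⊕ Κ 1ℚ) ⊗ q′ (M ⊕ Κ 1ℚ)

shiftʳ : ℕ → Bracket → Bracket → Bracket
shiftʳ k q q′ M = (M ⊕ Κ 1ℚ ⊖ Κ ⟦ k ⟧) ⊗ q′ M ⊖ Κ ⟦ k ⟧ ⊗ (M ⊖ Κ ⟦ k ⟧) ⊗ q M

shift₁ : ShiftIdentity 1 (bracket q₀) (bracket q₁)
shift₁ = solve 1 (λ M → shiftˡ q₁ M ⊜ shiftʳ 1 q₀ q₁ M) refl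

shift₂ : ShiftIdentity 2 (bracket q₁) (bracket q₂)
shift₂ = solve 1 (λ M → shiftˡ q₂ M ⊜ shiftʳ 2 q₁ q₂ M) refl

shift₃ : ShiftIdentity 3 (bracket q₂) (bracket q₃)
shift₃ = solve 1 (λ M → shiftˡ q₃ M ⊜ shiftʳ 3 q₂ q₃ M) refl

shift₄ : ShiftIdentity 4 (bracket q₃) (bracket q₄)
shift₄ = solve 1 (λ M → shiftˡ q₄ M ⊜ shiftʳ 4 q₃ q₄ M) refl

shift₅ : ShiftIdentity 5 (bracket q₄) (bracket q₅)
shift₅ = solve 1 (λ M → shiftˡ q₅ M ⊜ shiftʳ 5 q₄ q₅ M) refl

shift₆ : ShiftIdentity 6 (bracket q₅) (bracket q₆)
shift₆ = solve 1 (λ M → shiftˡ q₆ M ⊜ shiftʳ 6 q₅ q₆ M) refl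

shift₇ : ShiftIdentity 7 (bracket q₆) (bracket q₇)
shift₇ = solve 1 (λ M → shiftˡ q₇ M ⊜ shiftʳ 7 q₆ q₇ M) refl

closedForm-signed : ∀ j e (B : Bracket) t →
  closedForm j (bracket (signed e B)) t
    ≡ ⟦ t ! ⟧ * (⟦ e ⟧ - ⟦ 2 ℕ.+ j ℕ.+ t ⟧) * ⟦ (2 ℕ.+ j ℕ.+ t) C j ⟧ * bracket B ⟦ 2 ℕ.+ j ℕ.+ t ⟧
closedForm-signed j e B t = sign-first ⟦ t ! ⟧ ⟦ n C j ⟧ (⟦ e ⟧ - ⟦ n ⟧) (bracket B ⟦ n ⟧)
  where
  n : ℕ
  n = 2 ℕ.+ j ℕ.+ t
  sign-first : ∀ F Y s b → F * Y * (s * b) ≡ F * s * Y * b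
  sign-first = solve-∀ ℚ-ring

closedForm-q₁ : ∀ t →
  closedForm 1 (bracket q₁) t ≡ ⟦ t ! ⟧ * (⟦ 3 ⟧ - ⟦ 3 ℕ.+ t ⟧) * (+ 1 / 2) * ⟦ 3 ℕ.+ t ⟧
closedForm-q₁ t = begin
  closedForm 1 (bracket q₁) t
    ≡⟨ closedForm-signed 1 3 B₁ t ⟩
  ⟦ t ! ⟧ * s * ⟦ (3 ℕ.+ t) C 1 ⟧ * (+ 1 / 2)
    ≡⟨ cong (λ x → ⟦ t ! ⟧ * s * ⟦ x ⟧ * (+ 1 / 2)) (nC1≡n (3 ℕ.+ t)) ⟩
  ⟦ t ! ⟧ * s * ⟦ 3 ℕ.+ t ⟧ * (+ 1 / 2)
    ≡⟨ swap ⟦ t ! ⟧ s ⟦ 3 ℕ.+ t ⟧ (+ 1 / 2) ⟩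
  ⟦ t ! ⟧ * s * (+ 1 / 2) * ⟦ 3 ℕ.+ t ⟧ ∎
  where
  open ≡-Reasoning
  s : ℚ
  s = ⟦ 3 ⟧ - ⟦ 3 ℕ.+ t ⟧
  swap : ∀ F s x h → F * s * x * h ≡ F * s * h * x
  swap = solve-∀ ℚ-ring

module Coefficients (c : ℕ → ℕ → ℚ) (isCoeffs : IsCoeffs c) where

  row : ℕ → ℕ → ℚ
  row m i = c m (2 ℕ.+ i)

  power≡combination : ∀ J n → n ^ℚ (2 ℕ.+ J) ≡ combination (row (2 ℕ.+ J)) (suc J) n
  power≡combination J n = trans (isCoeffs (2 ℕ.+ J) (s≤s (s≤s z≤n)) n) (Σ₂≡sumBelow (suc J) _)

  row-sum : ∀ J → sumBelow (suc J) (row (2 ℕ.+ J)) ≡ 1ℚ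
  row-sum J = begin
    sumBelow (suc J) (row (2 ℕ.+ J))            ≡⟨ sym (combination-at-1 (row (2 ℕ.+ J)) (suc J)) ⟩
    combination (row (2 ℕ.+ J)) (suc J) 1ℚ      ≡⟨ sym (power≡combination J 1ℚ) ⟩
    1ℚ ^ℚ (2 ℕ.+ J)                             ≡⟨ 1^ℚn≡1 (2 ℕ.+ J) ⟩
    1ℚ                                          ∎
    where open ≡-Reasoning

  row-recurrence : ∀ J →
    (∀ i → i < suc J → row (3 ℕ.+ J) i ≡ nextRow (row (2 ℕ.+ J)) i)
      × c (3 ℕ.+ J) (3 ℕ.+ J) ≡ ⟦ suc J ⟧ * c (2 ℕ.+ J) (2 ℕ.+ J)
  row-recurrence J = combination-independent (suc J) (row (3 ℕ.+ J)) (nextRow a) _ _ λ n → begin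
    combination (row (3 ℕ.+ J)) (2 ℕ.+ J) n
      ≡⟨ sym (power≡combination (suc J) n) ⟩
    n * n ^ℚ (2 ℕ.+ J)
      ≡⟨ cong (n *_) (power≡combination J n) ⟩
    n * combination a (suc J) n
      ≡⟨ *-combination-nextRow a J n (row-sum J) ⟩
    combination (nextRow a) (suc J) n + ⟦ suc J ⟧ * c (2 ℕ.+ J) (2 ℕ.+ J) * ψ (3 ℕ.+ J) n ∎
    where
    open ≡-Reasoning
    a : ℕ → ℚ
    a = row (2 ℕ.+ J)

  c₂₂≡1 : c 2 2 ≡ 1ℚ
  c₂₂≡1 = trans (sym (ℚ.+-identityˡ (c 2 2))) (row-sum 0)

  column₂-recurrence : ∀ J → c (3 ℕ.+ J) 2 ≡ 1ℚ - c (2 ℕ.+ J) 2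
  column₂-recurrence J = proj₁ (row-recurrence J) 0 (s≤s z≤n)

  interior-recurrence : ∀ J i → i < J →
    c (3 ℕ.+ J) (3 ℕ.+ i) ≡ ⟦ suc i ⟧ * c (2 ℕ.+ J) (2 ℕ.+ i) - ⟦ 2 ℕ.+ i ⟧ * c (2 ℕ.+ J) (3 ℕ.+ i)
  interior-recurrence J i i<J = proj₁ (row-recurrence J) (suc i) (s≤s i<J)

  diagonal-recurrence : ∀ J → c (3 ℕ.+ J) (3 ℕ.+ J) ≡ ⟦ suc J ⟧ * c (2 ℕ.+ J) (2 ℕ.+ J)
  diagonal-recurrence J = proj₂ (row-recurrence J)

  -- diag j t = c m (m - j) with m = 2 + j + t.
  diag : ℕ → ℕ → ℚ
  diag j t = c (2 ℕ.+ j ℕ.+ t) (2 ℕ.+ t)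

  diag-start : ∀ j → diag (suc j) 0 ≡ 1ℚ - diag j 0
  diag-start j = column₂-recurrence (j ℕ.+ 0)

  diag-recurrence : ∀ j t →
    diag (suc j) (suc t) ≡ ⟦ suc t ⟧ * diag (suc j) t - ⟦ 2 ℕ.+ t ⟧ * diag j (suc t)
  diag-recurrence j t =
    trans (interior-recurrence (j ℕ.+ suc t) t (ℕ.m≤n+m (suc t) j))
          (cong (λ r → ⟦ suc t ⟧ * c (2 ℕ.+ r) (2 ℕ.+ t) - ⟦ 2 ℕ.+ t ⟧ * diag j (suc t)) (ℕ.+-suc j t))

  diag₀ : ∀ t → diag 0 t ≡ ⟦ t ! ⟧
  diag₀ zero    = c₂₂≡1
  diag₀ (suc t) = trans (diagonal-recurrence t)
                        (trans (cong (⟦ suc t ⟧ *_) (diag₀ t)) (sym (⟦⟧-homo-* (suc t) (t !))))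

  diag-closedForm : ∀ j {q q′} → ShiftIdentity (suc j) q q′ →
    closedForm (suc j) q′ 0 ≡ 1ℚ - closedForm j q 0 →
    (∀ t → diag j t ≡ closedForm j q t) → ∀ t → diag (suc j) t ≡ closedForm (suc j) q′ t
  diag-closedForm j shift start diag-j zero =
    trans (diag-start j) (trans (cong (1ℚ -_) (diag-j 0)) (sym start))
  diag-closedForm j {q} {q′} shift start diag-j (suc t) = begin
    diag (suc j) (suc t)
      ≡⟨ diag-recurrence j t ⟩
    ⟦ suc t ⟧ * diag (suc j) t - ⟦ 2 ℕ.+ t ⟧ * diag j (suc t)
      ≡⟨ cong₂ (λ x y → ⟦ suc t ⟧ * x - ⟦ 2 ℕ.+ t ⟧ * y)
               (diag-closedForm j shift start diag-j t) (diag-j (suc t)) ⟩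
    ⟦ suc t ⟧ * closedForm (suc j) q′ t - ⟦ 2 ℕ.+ t ⟧ * closedForm j q (suc t)
      ≡⟨ closedForm-recurrence j t shift ⟩
    closedForm (suc j) q′ (suc t) ∎
    where open ≡-Reasoning

  diag-q₀ : ∀ t → diag 0 t ≡ closedForm 0 (bracket q₀) t
  diag-q₀ t = trans (diag₀ t) (sym (x*1*1≡x ⟦ t ! ⟧))
    where
    x*1*1≡x : ∀ x → x * 1ℚ * 1ℚ ≡ x
    x*1*1≡x = solve-∀ ℚ-ring

  diag₁ : ∀ t → diag 1 t ≡ closedForm 1 (bracket q₁) t
  diag₁ = diag-closedForm 0 shift₁ refl diag-q₀

  diag₂ : ∀ t → diag 2 t ≡ closedForm 2 (bracket q₂) t
  diag₂ = diag-closedForm 1 shift₂ refl diag₁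

  diag₃ : ∀ t → diag 3 t ≡ closedForm 3 (bracket q₃) t
  diag₃ = diag-closedForm 2 shift₃ refl diag₂

  diag₄ : ∀ t → diag 4 t ≡ closedForm 4 (bracket q₄) t
  diag₄ = diag-closedForm 3 shift₄ refl diag₃

  diag₅ : ∀ t → diag 5 t ≡ closedForm 5 (bracket q₅) t
  diag₅ = diag-closedForm 4 shift₅ refl diag₄

  diag₆ : ∀ t → diag 6 t ≡ closedForm 6 (bracket q₆) t
  diag₆ = diag-closedForm 5 shift₆ refl diag₅

  diag₇ : ∀ t → diag 7 t ≡ closedForm 7 (bracket q₇) t
  diag₇ = diag-closedForm 6 shift₇ refl diag₆

fact4 : (c : ℕ → ℕ → ℚ) → IsCoeffs c →
  (∀ m → 2 ≤ m → c m m ≡ ⟦ (m ∸ 2) ! ⟧)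
  × (∀ m → 3 ≤ m → c m (m ∸ 1) ≡ ⟦ (m ∸ 3) ! ⟧ * (⟦ 3 ⟧ - ⟦ m ⟧) * (+ 1 / 2) * ⟦ m ⟧)
  × (∀ m → 4 ≤ m → c m (m ∸ 2) ≡ ⟦ (m ∸ 4) ! ⟧ * ⟦ m C 2 ⟧
      * ((+ 1 / 4) * ⟦ m ⟧ ^ℚ 2 - (+ 23 / 12) * ⟦ m ⟧ + (+ 46 / 12)))
  × (∀ m → 5 ≤ m → c m (m ∸ 3) ≡ ⟦ (m ∸ 5) ! ⟧ * (⟦ 5 ⟧ - ⟦ m ⟧) * ⟦ m C 3 ⟧
      * ((+ 1 / 8) * ⟦ m ⟧ ^ℚ 2 - (+ 9 / 8) * ⟦ m ⟧ + (+ 11 / 4)))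
  × (∀ m → 6 ≤ m → c m (m ∸ 4) ≡ ⟦ (m ∸ 6) ! ⟧ * ⟦ m C 4 ⟧
      * ((+ 1 / 16) * ⟦ m ⟧ ^ℚ 4 - (+ 11 / 8) * ⟦ m ⟧ ^ℚ 3 + (+ 553 / 48) * ⟦ m ⟧ ^ℚ 2
         - (+ 1747 / 40) * ⟦ m ⟧ + (+ 1901 / 30)))
  × (∀ m → 7 ≤ m → c m (m ∸ 5) ≡ ⟦ (m ∸ 7) ! ⟧ * (⟦ 7 ⟧ - ⟦ m ⟧) * ⟦ m C 5 ⟧
      * ((+ 1 / 32) * ⟦ m ⟧ ^ℚ 4 - (+ 37 / 48) * ⟦ m ⟧ ^ℚ 3 + (+ 697 / 96) * ⟦ m ⟧ ^ℚ 2
         - (+ 1489 / 48) * ⟦ m ⟧ + (+ 611 / 12)))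
  × (∀ m → 8 ≤ m → c m (m ∸ 6) ≡ ⟦ (m ∸ 8) ! ⟧ * ⟦ m C 6 ⟧
      * ((+ 1 / 64) * ⟦ m ⟧ ^ℚ 6 - (+ 43 / 64) * ⟦ m ⟧ ^ℚ 5 + (+ 775 / 64) * ⟦ m ⟧ ^ℚ 4
         - (+ 67513 / 576) * ⟦ m ⟧ ^ℚ 3 + (+ 1930 / 3) * ⟦ m ⟧ ^ℚ 2
         - (+ 1916141 / 1008) * ⟦ m ⟧ + (+ 198721 / 84)))
  × (∀ m → 9 ≤ m → c m (m ∸ 7) ≡ ⟦ (m ∸ 9) ! ⟧ * (⟦ 9 ⟧ - ⟦ m ⟧) * ⟦ m C 7 ⟧
      * ((+ 1 / 128) * ⟦ m ⟧ ^ℚ 6 - (+ 47 / 128) * ⟦ m ⟧ ^ℚ 5 + (+ 2777 / 384) * ⟦ m ⟧ ^ℚ 4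
         - (+ 88093 / 1152) * ⟦ m ⟧ ^ℚ 3 + (+ 14669 / 32) * ⟦ m ⟧ ^ℚ 2
         - (+ 425993 / 288) * ⟦ m ⟧ + (+ 16083 / 8)))
fact4 c isCoeffs =
    fromOffset 2 diag₀
  , fromOffset 3 (λ t → trans (diag₁ t) (closedForm-q₁ t))
  , fromOffset 4 diag₂
  , fromOffset 5 (λ t → trans (diag₃ t) (closedForm-signed 3 5 B₃ t))
  , fromOffset 6 diag₄
  , fromOffset 7 (λ t → trans (diag₅ t) (closedForm-signed 5 7 B₅ t))
  , fromOffset 8 diag₆
  , fromOffset 9 (λ t → trans (diag₇ t) (closedForm-signed 7 9 B₇ t))
  where open Coefficients c isCoeffs
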